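{- Let $q$ be a prime power, $n\ge5$, $E=\mathbb{F}_q^n$. For each $i\in\{1,\dots,n-2\}$ let $\mathcal{M}_i=\mathcal{U}_{i+1,n}(q)$ and let $\lambda_i=\frac{a_i}{b_i}\in\mathbb{Q}$ (with $a_i,b_i$ positive integers) satisfy $0<\lambda_i<1$ and $\sum_{i=1}^{n-2}\lambda_i=1$. Let $\mathcal{M}=\sum_{i=1}^{n-2}\lambda_i\mathcal{M}_i$ and $\mu=\mathrm{lcm}(b_1,\dots,b_{n-2})$. Then every subspace of $E$ of dimension at most $n-1$ is $\mu$-independent in $\mathcal{M}$. Moreover, if $\mu\ge\lceil n/2\rceil$, then $\mathcal{I}_\mu(\mathcal{M})=\mathcal{L}(E)$.
   Context: $\mathcal{L}(E)$ is the lattice of subspaces of $E$. The uniform $q$-matroid $\mathcal{U}_{k,n}(q)$ has rank function $\rho(V)=\min\{k,\dim V\}$. For $q$-polymatroids with rank functions $\rho_i$ and positive coefficients $\lambda_i$ summing to $1$, $\sum_i\lambda_i\mathcal{M}_i$ is the $q$-polymatroid with rank function $\sum_i\lambda_i\rho_i$. A space $I$ is $\mu$-independent if $\rho(J)\ge\dim(J)/\mu$ for all $J\le I$; $\mathcal{I}_\mu(\mathcal{M})$ denotes the set of $\mu$-independent spaces. -}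

module Defs where

open import Level using (Level; _⊔_)
open import Algebra.Bundles using (CommutativeRing)
open import Data.Nat as ℕ using (ℕ; zero; suc; NonZero; _≤_)
open import Data.Nat.LCM using (lcm; gcd*lcm)
open import Data.Nat.GCD using (gcd)
open import Data.Nat.Primality using (Prime)
import Data.Nat.Properties as ℕP
open import Data.Integer using (+_)
open import Data.Rational as ℚ using (ℚ; _/_)
open import Data.Fin using (Fin; zero; suc; toℕ)
open import Data.Sum using (inj₁; inj₂)
open import Data.Product using (Σ; ∃; ∃-syntax; _×_; _,_)
open import Relation.Nullary using (¬_)
open import Relation.Binary.PropositionalEquality using (_≡_; _≢_; refl; sym; trans; cong)

IsPrimePower : ℕ → Set
IsPrimePower q = Σ ℕ λ p → Σ ℕ λ k → Prime p × (1 ≤ k) × (q ≡ p ℕ.^ k)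

lcmFin : (m : ℕ) → (Fin m → ℕ) → ℕ
lcmFin zero    b = 1
lcmFin (suc m) b = lcm (b zero) (lcmFin m (λ i → b (suc i)))

lcm≢0 : ∀ m n → m ≢ 0 → n ≢ 0 → lcm m n ≢ 0
lcm≢0 m n m≢0 n≢0 l≡0 with ℕP.m*n≡0⇒m≡0∨n≡0 m mn≡0
  where
  mn≡0 : m ℕ.* n ≡ 0
  mn≡0 = trans (sym (gcd*lcm m n)) (trans (cong (gcd m n ℕ.*_) l≡0) (ℕP.*-zeroʳ (gcd m n)))
... | inj₁ m≡0 = m≢0 m≡0
... | inj₂ n≡0 = n≢0 n≡0

lcmFin≢0 : ∀ m (b : Fin m → ℕ) → (∀ i → NonZero (b i)) → lcmFin m b ≢ 0
lcmFin≢0 zero    b nz ()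
lcmFin≢0 (suc m) b nz = lcm≢0 (b zero) _ (ℕ.≢-nonZero⁻¹ (b zero) {{nz zero}})
                          (lcmFin≢0 m (λ i → b (suc i)) (λ i → nz (suc i)))

lcmFin-nonZero : ∀ m (b : Fin m → ℕ) → (∀ i → NonZero (b i)) → NonZero (lcmFin m b)
lcmFin-nonZero m b nz = ℕ.≢-nonZero (lcmFin≢0 m b nz)

frac : ∀ {m} (a b : Fin m → ℕ) → (∀ i → NonZero (b i)) → Fin m → ℚ
frac a b nz i = _/_ (+ a i) (b i) {{nz i}}

sumℚ : (m : ℕ) → (Fin m → ℚ) → ℚ
sumℚ zero    f = ℚ.0ℚ
sumℚ (suc m) f = f zero ℚ.+ sumℚ m (λ i → f (suc i))

module LinAlg {c ℓ : Level} (K : CommutativeRing c ℓ) where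
  open CommutativeRing K using (_≈_; _+_; _*_; 0#; 1#) renaming (Carrier to F)

  IsField : Set (c ⊔ ℓ)
  IsField = (¬ (1# ≈ 0#)) × (∀ x → ¬ (x ≈ 0#) → ∃[ y ] (x * y ≈ 1#))

  HasCard : ℕ → Set (c ⊔ ℓ)
  HasCard q = Σ (Fin q → F) λ e → (∀ x → ∃[ i ] (e i ≈ x)) × (∀ i j → e i ≈ e j → i ≡ j)

  Vect : ℕ → Set c
  Vect n = Fin n → F

  _≋_ : ∀ {n} → Vect n → Vect n → Set ℓ
  u ≋ v = ∀ j → u j ≈ v j

  zeroV : ∀ {n} → Vect n
  zeroV j = 0#

  _+V_ : ∀ {n} → Vect n → Vect n → Vect n
  (u +V v) j = u j + v j

  _·V_ : ∀ {n} → F → Vect n → Vect n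
  (x ·V v) j = x * v j

  lincomb : ∀ {n} d → (Fin d → F) → (Fin d → Vect n) → Vect n
  lincomb zero    cs vs = zeroV
  lincomb (suc d) cs vs = (cs zero ·V vs zero) +V lincomb d (λ i → cs (suc i)) (λ i → vs (suc i))

  record Subspace (n : ℕ) : Set (Level.suc (c ⊔ ℓ)) where
    field
      _∈V      : Vect n → Set (c ⊔ ℓ)
      resp     : ∀ {u v} → u ≋ v → u ∈V → v ∈V
      zero∈    : zeroV ∈V
      +-closed : ∀ {u v} → u ∈V → v ∈V → (u +V v) ∈V
      ·-closed : ∀ x {v} → v ∈V → (x ·V v) ∈V
  open Subspace public

  _⊆S_ : ∀ {n} → Subspace n → Subspace n → Set (c ⊔ ℓ)
  V ⊆S W = ∀ v → _∈V V v → _∈V W v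

  HasDim : ∀ {n} → Subspace n → ℕ → Set (c ⊔ ℓ)
  HasDim {n} V d = Σ (Fin d → Vect n) λ bs →
      (∀ i → _∈V V (bs i))
    × (∀ cs → lincomb d cs bs ≋ zeroV → ∀ i → cs i ≈ 0#)
    × (∀ v → _∈V V v → ∃[ cs ] (v ≋ lincomb d cs bs))

  -- rank function of the uniform q-matroid U_{k,n}(q): ρ(V) = min{k, dim V}
  rankU : ∀ {n} (k : ℕ) (V : Subspace n) {d} → HasDim V d → ℕ
  rankU k V {d} _ = ℕ._⊓_ k d

  -- rank function of M = Σᵢ λᵢ Mᵢ, Mᵢ = U_{i+1,n}(q), i = 1,…,n-2
  -- (index i : Fin (n ∸ 2) stands for the paper's index toℕ i + 1)
  rankM : ∀ {n} (lam : Fin (n ℕ.∸ 2) → ℚ) (V : Subspace n) {d} → HasDim V d → ℚ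
  rankM {n} lam V hd =
    sumℚ (n ℕ.∸ 2) (λ i → lam i ℚ.* ((+ rankU (toℕ i ℕ.+ 2) V hd) / 1))

  MuIndependent : ∀ {n} (lam : Fin (n ℕ.∸ 2) → ℚ) (μ : ℕ) .{{_ : NonZero μ}} →
                  Subspace n → Set (Level.suc (c ⊔ ℓ))
  MuIndependent {n} lam μ I = ∀ (J : Subspace n) → J ⊆S I → ∀ d (hd : HasDim J d) →
                          (+ d) / μ ℚ.≤ rankM lam J hd

{-# OPTIONS --safe #-}
-- The rank of J depends only on d = dim J, so μ-independence is an inequality between rationals.
-- If d ≤ n - 1, the last summand alone is λ_{n-2} · min(n-1, d) = (a/b) · d ≥ d/μ, since a ≥ 1 and b ∣ μ.
-- If d = n, every summand has min(i+1, n) ≥ 2, so ρ(J) ≥ 2 Σ λᵢ = 2 ≥ n/μ once μ ≥ ⌈n/2⌉.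
-- The dimension bounds dim J ≤ dim I ≤ n come from Gaussian elimination: k independent rows of
-- length m force k ≤ m.
module Submission where

open import Level using (_⊔_)
open import Algebra.Bundles using (CommutativeRing)
open import Data.Nat as ℕ using (ℕ; zero; suc; _≤_; _∸_; NonZero; ⌈_/2⌉; ⌊_/2⌋; z≤n; s≤s)
import Data.Nat.Properties as ℕP
open import Data.Nat.Divisibility using (_∣_; ∣⇒≤; ∣-trans)
open import Data.Nat.LCM using (m∣lcm[m,n]; n∣lcm[m,n])
open import Data.Integer as ℤ using (+_; +≤+)
import Data.Integer.Properties as ℤP
open import Data.Rational as ℚ using (ℚ; _/_; 0ℚ; 1ℚ; _<_; toℚᵘ)
import Data.Rational.Properties as ℚP
import Data.Rational.Unnormalised as ℚᵘ
import Data.Rational.Unnormalised.Properties as ℚᵘP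
open import Data.Fin using (Fin; zero; suc; toℕ; fromℕ; punchIn)
import Data.Fin.Properties as FinP
open import Data.Vec.Functional using (insertAt)
open import Data.Vec.Functional.Properties using (insertAt-lookup; insertAt-punchIn)
open import Data.Product using (_×_; _,_; proj₁; proj₂)
open import Data.Sum using (inj₁; inj₂)
open import Data.Empty using (⊥-elim)
open import Relation.Nullary using (yes; no; ¬?)
open import Relation.Nullary.Decidable using (decidable-stable)
open import Relation.Binary.Definitions using (Decidable)
open import Relation.Binary.PropositionalEquality as ≡ using (_≡_)
open import Defs

module LinearAlgebra {c ℓ} (K : CommutativeRing c ℓ) where
  open CommutativeRing K hiding (zero) renaming (Carrier to F)
  open import Algebra.Properties.Semiring.Sum semiring
  open import Algebra.Properties.Ring ring using (-‿distribˡ-*)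
  open import Relation.Binary.Reasoning.Setoid setoid
  open LinAlg K

  hasCard⇒≈-dec : ∀ {q} → HasCard q → Decidable _≈_
  hasCard⇒≈-dec (e , surj , inj) x y with surj x | surj y
  ... | i , eᵢ≈x | j , eⱼ≈y with i FinP.≟ j
  ... | yes ≡.refl = yes (trans (sym eᵢ≈x) eⱼ≈y)
  ... | no i≢j   = no (λ x≈y → i≢j (inj i j (trans eᵢ≈x (trans x≈y (sym eⱼ≈y)))))

  Independent : ∀ {n} d → (Fin d → Vect n) → Set (c ⊔ ℓ)
  Independent d vs = ∀ cs → lincomb d cs vs ≋ zeroV → ∀ i → cs i ≈ 0#

  RowIndependent : ∀ {k m} → (Fin k → Fin m → F) → Set (c ⊔ ℓ)
  RowIndependent {k} r = ∀ (x : Fin k → F) → (∀ l → sum (λ j → x j * r j l) ≈ 0#) → ∀ j → x j ≈ 0#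

  lincomb≈sum : ∀ {n} d cs (vs : Fin d → Vect n) t → lincomb d cs vs t ≈ sum (λ i → cs i * vs i t)
  lincomb≈sum zero    cs vs t = refl
  lincomb≈sum (suc d) cs vs t = +-congˡ (lincomb≈sum d (λ i → cs (suc i)) (λ i → vs (suc i)) t)

  independent⇒rowIndependent : ∀ {n k} {v : Fin k → Vect n} → Independent k v → RowIndependent v
  independent⇒rowIndependent {k = k} {v} ind x h = ind x (λ t → trans (lincomb≈sum k x v t) (h t))

  coordinates-rowIndependent : ∀ {n k m} {v : Fin k → Vect n} {w : Fin m → Vect n} {C : Fin k → Fin m → F} →
                               Independent k v → (∀ j → v j ≋ lincomb m (C j) w) → RowIndependent C
  coordinates-rowIndependent {k = k} {m} {v} {w} {C} ind v≋Cw x h = ind x λ t → begin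
    lincomb k x v t                               ≈⟨ lincomb≈sum k x v t ⟩
    sum (λ j → x j * v j t)                       ≈⟨ sum-cong-≋ (λ j → *-congˡ (trans (v≋Cw j t) (lincomb≈sum m (C j) w t))) ⟩
    sum (λ j → x j * sum (λ l → C j l * w l t))   ≈⟨ sum-cong-≋ (λ j → *-distribˡ-sum (x j) (λ l → C j l * w l t)) ⟩
    sum (λ j → sum (λ l → x j * (C j l * w l t))) ≈⟨ ∑-comm (λ j l → x j * (C j l * w l t)) ⟩
    sum (λ l → sum (λ j → x j * (C j l * w l t))) ≈⟨ sum-cong-≋ (λ l → sym (trans (*-distribʳ-sum (w l t) (λ j → x j * C j l))
                                                                     (sum-cong-≋ (λ j → *-assoc (x j) (C j l) (w l t))))) ⟩
    sum (λ l → sum (λ j → x j * C j l) * w l t)   ≈⟨ sum-cong-≋ (λ l → trans (*-congʳ (h l)) (zeroˡ (w l t))) ⟩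
    sum {m} (λ _ → 0#)                            ≈⟨ sum-replicate-zero m ⟩
    0#                                            ∎

  rowIndependent-dropZeroColumn : ∀ {k m} {r : Fin k → Fin (suc m) → F} → (∀ j → r j zero ≈ 0#) →
                                  RowIndependent r → RowIndependent (λ j l → r j (suc l))
  rowIndependent-dropZeroColumn {k} {r = r} r₀≈0 ind x h = ind x λ where
    zero    → trans (sum-cong-≋ (λ j → trans (*-congˡ (r₀≈0 j)) (zeroʳ (x j)))) (sum-replicate-zero k)
    (suc l) → h l

  -- A dependency x among the new rows lifts to one among the old rows, with coefficient Σⱼ xⱼ sⱼ at row p.
  rowIndependent-eliminate : ∀ {k m} (r : Fin (suc k) → Fin m → F) (p : Fin (suc k)) (s : Fin k → F) →
                             RowIndependent r → RowIndependent (λ j l → r (punchIn p j) l + s j * r p l)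
  rowIndependent-eliminate r p s ind x h j =
    trans (reflexive (≡.sym (insertAt-punchIn x p t j))) (ind y hy (punchIn p j))
    where
    t = sum (λ j → x j * s j)
    y = insertAt x p t
    regroup : ∀ u σ a b → u * σ * b + u * a ≈ u * (a + σ * b)
    regroup u σ a b = trans (+-comm _ _) (trans (+-congˡ (*-assoc u σ b)) (sym (distribˡ u a (σ * b))))
    hy : ∀ l → sum (λ i → y i * r i l) ≈ 0#
    hy l = begin
      sum (λ i → y i * r i l)
        ≈⟨ sum-remove {i = p} (λ i → y i * r i l) ⟩
      y p * r p l + sum (λ j → y (punchIn p j) * r (punchIn p j) l)
        ≡⟨ ≡.cong₂ _+_ (≡.cong (_* r p l) (insertAt-lookup x p t))
                       (sum-cong-≗ (λ j → ≡.cong (_* r (punchIn p j) l) (insertAt-punchIn x p t j))) ⟩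
      t * r p l + sum (λ j → x j * r (punchIn p j) l)
        ≈⟨ +-congʳ (*-distribʳ-sum (r p l) (λ j → x j * s j)) ⟩
      sum (λ j → x j * s j * r p l) + sum (λ j → x j * r (punchIn p j) l)
        ≈⟨ sym (∑-distrib-+ (λ j → x j * s j * r p l) (λ j → x j * r (punchIn p j) l)) ⟩
      sum (λ j → x j * s j * r p l + x j * r (punchIn p j) l)
        ≈⟨ sum-cong-≋ (λ j → regroup (x j) (s j) (r (punchIn p j) l) (r p l)) ⟩
      sum (λ j → x j * (r (punchIn p j) l + s j * r p l))
        ≈⟨ h l ⟩
      0# ∎

  pivot-cancel : ∀ {a p w} → p * w ≈ 1# → a + - (a * w) * p ≈ 0#
  pivot-cancel {a} {p} {w} pw≈1 = begin
    a + - (a * w) * p  ≈⟨ +-congˡ (sym (-‿distribˡ-* (a * w) p)) ⟩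
    a + - (a * w * p)  ≈⟨ +-congˡ (-‿cong (trans (*-assoc a w p) (*-congˡ (trans (*-comm w p) pw≈1)))) ⟩
    a + - (a * 1#)     ≈⟨ +-congˡ (-‿cong (*-identityʳ a)) ⟩
    a + - a            ≈⟨ -‿inverseʳ a ⟩
    0#                 ∎

  -- Gaussian elimination has to decide whether a column contains a pivot.
  module Dimension (isField : IsField) (_≟_ : Decidable _≈_) where

    rowIndependent⇒≤ : ∀ {k m} (r : Fin k → Fin m → F) → RowIndependent r → k ≤ m
    rowIndependent⇒≤ {zero}          r ind = z≤n
    rowIndependent⇒≤ {suc k} {zero}  r ind = ⊥-elim (proj₁ isField (ind (λ _ → 1#) (λ ()) zero))
    rowIndependent⇒≤ {suc k} {suc m} r ind with FinP.any? (λ j → ¬? (r j zero ≟ 0#))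
    ... | no noPivot = ℕP.m≤n⇒m≤1+n
                         (rowIndependent⇒≤ (λ j l → r j (suc l)) (rowIndependent-dropZeroColumn {r = r} zeroColumn ind))
      where
      zeroColumn : ∀ j → r j zero ≈ 0#
      zeroColumn j = decidable-stable (r j zero ≟ 0#) (λ r≉0 → noPivot (j , r≉0))
    ... | yes (p , r≉0) = s≤s (rowIndependent⇒≤ (λ j l → r′ j (suc l))
                            (rowIndependent-dropZeroColumn {r = r′} (λ _ → pivot-cancel pw≈1)
                              (rowIndependent-eliminate r p s ind)))
      where
      w : F
      w = proj₁ (proj₂ isField (r p zero) r≉0)
      pw≈1 : r p zero * w ≈ 1#
      pw≈1 = proj₂ (proj₂ isField (r p zero) r≉0)
      s : Fin k → F
      s j = - (r (punchIn p j) zero * w)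
      r′ : Fin k → Fin (suc m) → F
      r′ j l = r (punchIn p j) l + s j * r p l

    HasDim-mono : ∀ {n} {I J : Subspace n} {d₀ d} → J ⊆S I → HasDim I d₀ → HasDim J d → d ≤ d₀
    HasDim-mono J⊆I (_ , _ , _ , spanI) (vJ , vJ∈J , indJ , _) =
      rowIndependent⇒≤ _ (coordinates-rowIndependent indJ (λ j → proj₂ (spanI (vJ j) (J⊆I _ (vJ∈J j)))))

    HasDim⇒≤ : ∀ {n} {J : Subspace n} {d} → HasDim J d → d ≤ n
    HasDim⇒≤ (vJ , _ , indJ , _) = rowIndependent⇒≤ vJ (independent⇒rowIndependent indJ)

p≤p+q : ∀ {p q} → 0ℚ ℚ.≤ q → p ℚ.≤ p ℚ.+ q
p≤p+q {p} q≥0 = ℚP.≤-trans (ℚP.≤-reflexive (≡.sym (ℚP.+-identityʳ p))) (ℚP.+-monoʳ-≤ p q≥0)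

p≤q+p : ∀ {p q} → 0ℚ ℚ.≤ q → p ℚ.≤ q ℚ.+ p
p≤q+p {p} {q} q≥0 = ℚP.≤-trans (p≤p+q q≥0) (ℚP.≤-reflexive (ℚP.+-comm p q))

sumℚ-nonNeg : ∀ m (f : Fin m → ℚ) → (∀ i → 0ℚ ℚ.≤ f i) → 0ℚ ℚ.≤ sumℚ m f
sumℚ-nonNeg zero    f f≥0 = ℚP.≤-refl
sumℚ-nonNeg (suc m) f f≥0 = ℚP.+-mono-≤ (f≥0 zero) (sumℚ-nonNeg m (λ i → f (suc i)) (λ i → f≥0 (suc i)))

term≤sumℚ : ∀ m (f : Fin m → ℚ) → (∀ i → 0ℚ ℚ.≤ f i) → ∀ i → f i ℚ.≤ sumℚ m f
term≤sumℚ (suc m) f f≥0 zero    = p≤p+q (sumℚ-nonNeg m (λ i → f (suc i)) (λ i → f≥0 (suc i)))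
term≤sumℚ (suc m) f f≥0 (suc i) = ℚP.≤-trans (term≤sumℚ m (λ i → f (suc i)) (λ i → f≥0 (suc i)) i)
                                             (p≤q+p (f≥0 zero))

sumℚ-mono-≤ : ∀ m (f g : Fin m → ℚ) → (∀ i → f i ℚ.≤ g i) → sumℚ m f ℚ.≤ sumℚ m g
sumℚ-mono-≤ zero    f g f≤g = ℚP.≤-refl
sumℚ-mono-≤ (suc m) f g f≤g =
  ℚP.+-mono-≤ (f≤g zero) (sumℚ-mono-≤ m (λ i → f (suc i)) (λ i → g (suc i)) (λ i → f≤g (suc i)))

sumℚ-*-distribʳ : ∀ m (f : Fin m → ℚ) r → sumℚ m (λ i → f i ℚ.* r) ≡ sumℚ m f ℚ.* r
sumℚ-*-distribʳ zero    f r = ≡.sym (ℚP.*-zeroˡ r)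
sumℚ-*-distribʳ (suc m) f r = ≡.trans (≡.cong (f zero ℚ.* r ℚ.+_) (sumℚ-*-distribʳ m (λ i → f (suc i)) r))
                                      (≡.sym (ℚP.*-distribʳ-+ r (f zero) _))

toℚᵘ-/ : ∀ x y .{{_ : NonZero y}} → toℚᵘ ((+ x) / y) ℚᵘ.≃ ((+ x) ℚᵘ./ y)
toℚᵘ-/ x (suc y) = ℚP.toℚᵘ-fromℚᵘ (ℚᵘ.mkℚᵘ (+ x) y)

*≤*⇒/≤/ : ∀ x y u v .{{_ : NonZero y}} .{{_ : NonZero v}} → x ℕ.* v ≤ u ℕ.* y → (+ x) / y ℚ.≤ (+ u) / v
*≤*⇒/≤/ x y@(suc _) u v@(suc _) xv≤uy = ℚP.toℚᵘ-cancel-≤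
  (ℚᵘP.≤-respˡ-≃ (ℚᵘP.≃-sym (toℚᵘ-/ x y)) (ℚᵘP.≤-respʳ-≃ (ℚᵘP.≃-sym (toℚᵘ-/ u v))
    (ℚᵘ.*≤* (≡.subst₂ ℤ._≤_ (ℤP.pos-* x v) (ℤP.pos-* u y) (+≤+ xv≤uy)))))

[d/μ]≤[a/b]*d : ∀ {a b μ} d .{{_ : NonZero b}} .{{_ : NonZero μ}} → 1 ≤ a → b ≤ μ →
                (+ d) / μ ℚ.≤ ((+ a) / b) ℚ.* ((+ d) / 1)
[d/μ]≤[a/b]*d {a} {b@(suc _)} {μ@(suc _)} d (s≤s _) b≤μ = ℚP.toℚᵘ-cancel-≤
  (ℚᵘP.≤-respˡ-≃ (ℚᵘP.≃-sym (toℚᵘ-/ d μ)) (ℚᵘP.≤-respʳ-≃ (ℚᵘP.≃-sym product) (ℚᵘ.*≤* cross)))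
  where
  product : toℚᵘ (((+ a) / b) ℚ.* ((+ d) / 1)) ℚᵘ.≃ ((+ a) ℚᵘ./ b) ℚᵘ.* ((+ d) ℚᵘ./ 1)
  product = ℚᵘP.≃-trans (ℚP.toℚᵘ-homo-* ((+ a) / b) ((+ d) / 1)) (ℚᵘP.*-cong (toℚᵘ-/ a b) (toℚᵘ-/ d 1))
  cross : + d ℤ.* + (b ℕ.* 1) ℤ.≤ (+ a ℤ.* + d) ℤ.* + μ
  cross = ≡.subst₂ ℤ._≤_ (ℤP.pos-* d (b ℕ.* 1)) (≡.trans (ℤP.pos-* (a ℕ.* d) μ) (≡.cong (ℤ._* + μ) (ℤP.pos-* a d)))
            (+≤+ (begin
              d ℕ.* (b ℕ.* 1) ≡⟨ ≡.cong (d ℕ.*_) (ℕP.*-identityʳ b) ⟩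
              d ℕ.* b         ≤⟨ ℕP.*-monoʳ-≤ d b≤μ ⟩
              d ℕ.* μ         ≤⟨ ℕP.*-monoˡ-≤ μ (ℕP.m≤m*n d a) ⟩
              (d ℕ.* a) ℕ.* μ ≡⟨ ≡.cong (ℕ._* μ) (ℕP.*-comm d a) ⟩
              (a ℕ.* d) ℕ.* μ ∎))
    where open ℕP.≤-Reasoning

-- rankM lam V reduces to weightedRank (n ∸ 2) lam d for V of dimension d.
weightedRank : ∀ N → (Fin N → ℚ) → ℕ → ℚ
weightedRank N lam d = sumℚ N (λ i → lam i ℚ.* ((+ ((toℕ i ℕ.+ 2) ℕ.⊓ d)) / 1))

module _ {N} (lam : Fin N → ℚ) (lam≥0 : ∀ i → 0ℚ ℚ.≤ lam i) where

  term≤weightedRank : ∀ d i → lam i ℚ.* ((+ ((toℕ i ℕ.+ 2) ℕ.⊓ d)) / 1) ℚ.≤ weightedRank N lam d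
  term≤weightedRank d = term≤sumℚ N _ λ i → ℚP.≤-trans (ℚP.≤-reflexive (≡.sym (ℚP.*-zeroʳ (lam i))))
    (ℚP.*-monoˡ-≤-nonNeg (lam i) {{ℚ.nonNegative (lam≥0 i)}} (*≤*⇒/≤/ 0 1 ((toℕ i ℕ.+ 2) ℕ.⊓ d) 1 z≤n))

  2≤weightedRank : sumℚ N lam ≡ 1ℚ → ∀ {d} → 2 ≤ d → (+ 2) / 1 ℚ.≤ weightedRank N lam d
  2≤weightedRank Σlam≡1 {d} 2≤d = begin
    (+ 2) / 1                               ≡⟨ ≡.sym (ℚP.*-identityˡ _) ⟩
    1ℚ ℚ.* ((+ 2) / 1)                      ≡⟨ ≡.cong (ℚ._* ((+ 2) / 1)) (≡.sym Σlam≡1) ⟩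
    sumℚ N lam ℚ.* ((+ 2) / 1)              ≡⟨ ≡.sym (sumℚ-*-distribʳ N lam _) ⟩
    sumℚ N (λ i → lam i ℚ.* ((+ 2) / 1))    ≤⟨ sumℚ-mono-≤ N _ _ 2≤min ⟩
    weightedRank N lam d                    ∎
    where
    open ℚP.≤-Reasoning
    2≤min : ∀ i → lam i ℚ.* ((+ 2) / 1) ℚ.≤ lam i ℚ.* ((+ ((toℕ i ℕ.+ 2) ℕ.⊓ d)) / 1)
    2≤min i = ℚP.*-monoˡ-≤-nonNeg (lam i) {{ℚ.nonNegative (lam≥0 i)}}
                (*≤*⇒/≤/ 2 1 ((toℕ i ℕ.+ 2) ℕ.⊓ d) 1 (ℕP.*-monoˡ-≤ 1 (ℕP.⊓-glb (ℕP.m≤n+m 2 (toℕ i)) 2≤d)))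

weightedRank-top : ∀ {m} (lam : Fin (suc m) → ℚ) → (∀ i → 0ℚ ℚ.≤ lam i) →
                   ∀ {d} → d ≤ suc (suc m) → lam (fromℕ m) ℚ.* ((+ d) / 1) ℚ.≤ weightedRank (suc m) lam d
weightedRank-top {m} lam lam≥0 {d} d≤m+2 =
  ≡.subst (λ k → lam (fromℕ m) ℚ.* ((+ k) / 1) ℚ.≤ weightedRank (suc m) lam d) top⊓d≡d
          (term≤weightedRank lam lam≥0 d (fromℕ m))
  where
  top⊓d≡d : (toℕ (fromℕ m) ℕ.+ 2) ℕ.⊓ d ≡ d
  top⊓d≡d = ℕP.m≥n⇒m⊓n≡n
    (≡.subst (d ≤_) (≡.trans (ℕP.+-comm 2 m) (≡.cong (ℕ._+ 2) (≡.sym (FinP.toℕ-fromℕ m)))) d≤m+2)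

∣lcmFin : ∀ m (b : Fin m → ℕ) i → b i ∣ lcmFin m b
∣lcmFin (suc m) b zero    = m∣lcm[m,n] (b zero) _
∣lcmFin (suc m) b (suc i) = ∣-trans (∣lcmFin m (λ i → b (suc i)) i) (n∣lcm[m,n] (b zero) _)

⌈n/2⌉≤m⇒n≤2*m : ∀ {n m} → ⌈ n /2⌉ ≤ m → n ≤ 2 ℕ.* m
⌈n/2⌉≤m⇒n≤2*m {n} {m} ⌈n/2⌉≤m = begin
  n                   ≡⟨ ≡.sym (ℕP.⌊n/2⌋+⌈n/2⌉≡n n) ⟩
  ⌊ n /2⌋ ℕ.+ ⌈ n /2⌉ ≤⟨ ℕP.+-mono-≤ (ℕP.≤-trans (ℕP.⌊n/2⌋≤⌈n/2⌉ n) ⌈n/2⌉≤m) ⌈n/2⌉≤m ⟩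
  m ℕ.+ m             ≡⟨ ≡.cong (m ℕ.+_) (≡.sym (ℕP.+-identityʳ m)) ⟩
  2 ℕ.* m             ∎
  where open ℕP.≤-Reasoning

theorem6p5 : ∀ {c ℓ} (K : CommutativeRing c ℓ) → let open LinAlg K in
    (q : ℕ) → IsPrimePower q → IsField → HasCard q →
    (n : ℕ) → 5 ≤ n →
    (a b : Fin (n ∸ 2) → ℕ) → (∀ i → 1 ≤ a i) → (bnz : ∀ i → NonZero (b i)) →
    (∀ i → (0ℚ < frac a b bnz i) × (frac a b bnz i < 1ℚ)) →
    sumℚ (n ∸ 2) (frac a b bnz) ≡ 1ℚ →
    ((I : Subspace n) → ∀ d → HasDim I d → d ≤ n ∸ 1 →
       MuIndependent (frac a b bnz) (lcmFin (n ∸ 2) b) {{lcmFin-nonZero (n ∸ 2) b bnz}} I)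
    × (⌈ n /2⌉ ≤ lcmFin (n ∸ 2) b →
       (I : Subspace n) → MuIndependent (frac a b bnz) (lcmFin (n ∸ 2) b) {{lcmFin-nonZero (n ∸ 2) b bnz}} I)
theorem6p5 K q _ isField card n@(suc (suc (suc m))) _ a b 1≤a bnz 0<lam<1 Σlam≡1 = small , large
  where
  open LinAlg K
  open LinearAlgebra.Dimension K isField (LinearAlgebra.hasCard⇒≈-dec K card)
  μ = lcmFin (suc m) b
  instance
    μ≢0 : NonZero μ
    μ≢0 = lcmFin-nonZero (suc m) b bnz
  lam = frac a b bnz
  lam≥0 : ∀ i → 0ℚ ℚ.≤ lam i
  lam≥0 i = ℚP.<⇒≤ (proj₁ (0<lam<1 i))
  below-n : ∀ {d} → d ≤ suc (suc m) → (+ d) / μ ℚ.≤ weightedRank (suc m) lam d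
  below-n {d} d≤n-1 =
    ℚP.≤-trans ([d/μ]≤[a/b]*d d {{bnz (fromℕ m)}} (1≤a (fromℕ m)) (∣⇒≤ (∣lcmFin (suc m) b (fromℕ m))))
               (weightedRank-top lam lam≥0 d≤n-1)
  at-n : ⌈ n /2⌉ ≤ μ → (+ n) / μ ℚ.≤ weightedRank (suc m) lam n
  at-n ⌈n/2⌉≤μ =
    ℚP.≤-trans (*≤*⇒/≤/ n μ 2 1 (≡.subst (ℕ._≤ 2 ℕ.* μ) (≡.sym (ℕP.*-identityʳ n)) (⌈n/2⌉≤m⇒n≤2*m ⌈n/2⌉≤μ)))
               (2≤weightedRank lam lam≥0 Σlam≡1 (s≤s (s≤s z≤n)))
  small : (I : Subspace n) → ∀ d → HasDim I d → d ≤ n ∸ 1 → MuIndependent lam μ I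
  small I d₀ dimI d₀≤n-1 J J⊆I d dimJ = below-n (ℕP.≤-trans (HasDim-mono {I = I} {J} J⊆I dimI dimJ) d₀≤n-1)
  large : ⌈ n /2⌉ ≤ μ → (I : Subspace n) → MuIndependent lam μ I
  large ⌈n/2⌉≤μ I J _ d dimJ with ℕP.m≤n⇒m<n∨m≡n (HasDim⇒≤ {J = J} dimJ)
  ... | inj₁ d<n    = below-n (ℕP.≤-pred d<n)
  ... | inj₂ ≡.refl = at-n ⌈n/2⌉≤μ
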